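{- Let $\alpha,\beta$ be positive integers with $\alpha\geq\beta$. Then $$ \sum_{j=0}^{\alpha-\beta}\frac{1}{j+\beta}\binom{ -\alpha-1}{j}\binom{\alpha-\beta}{j} =\sum_{j=0}^{\beta-1}\frac{(-1)^{1+\alpha}}{j+1+\alpha-\beta}\binom{ -\alpha-1}{j}\binom{\beta-1}{j}. $$
   Context: For an integer (possibly negative) $x$ and a non-negative integer $j$, $\binom{x}{j}=\frac{x(x-1)\cdots(x-j+1)}{j!}$. -}

module Defs where

open import Data.Nat as ℕ using (ℕ; zero; suc; _!)
open import Data.Nat.Properties using (_!≢0)
open import Data.Integer as ℤ using (ℤ; +_)
open import Data.Rational as ℚ using (ℚ)

falling : ℤ → ℕ → ℤ
falling x zero    = + 1
falling x (suc j) = falling x j ℤ.* (x ℤ.- + j)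

binom : ℤ → ℕ → ℚ
binom x j = (falling x j ℚ./ (j !)) {{j !≢0}}

sumTo : ℕ → (ℕ → ℚ) → ℚ
sumTo zero    f = f 0
sumTo (suc n) f = sumTo n f ℚ.+ f (suc n)

signPow : ℕ → ℚ
signPow zero    = ℚ.1ℚ
signPow (suc k) = ℚ.- signPow k

-- Write β = m + 1 and α = m + n + 1.  Since binom (−α−1) j = (−1)ʲ C(j+α, j), clearing factorials turns
-- the j-th summand on the left into (m! n! / α!) (−1)ʲ C(n,j) C(m+j,m) C(j+α,n); the right-hand summand is
-- (−1)^(α+1) times the same expression with m and n exchanged.  An alternating sum Σⱼ (−1)ʲ C(n,j) g(j) is
-- an n-th finite difference, so expanding C(m+j,m) = Σₖ C(m,k) C(j,k) (Vandermonde) and using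
-- Σⱼ (−1)ʲ C(n,j) C(j,k) C(j+c,q+n) = (−1)ⁿ C(n,k) C(k+c,q+k) (induction on n via Pascal's rule), the left
-- side becomes (m! n! / α!) (−1)ⁿ Σₖ C(m,k) C(n,k) C(k+α,k).  This sum is symmetric in m and n, and the
-- signs agree because (−1)^(α+1) (−1)ᵐ = (−1)ⁿ.

module Submission where

open import Defs
open import Data.Nat as ℕ using (ℕ; suc; _∸_; _+_; _≤_)
open import Data.Integer as ℤ using (ℤ; +_; -[1+_])
open import Data.Rational as ℚ using (ℚ)
open import Relation.Binary.PropositionalEquality using (_≡_)

open import Data.Nat using (zero; _*_; _!; s≤s; z≤n; pred; NonZero)
open import Data.Nat.Combinatorics
  using (_C_; nCk+nC[k+1]≡[n+1]C[k+1]; k>n⇒nCk≡0; nC1≡n; nCk≡n!/k![n-k]!; k![n∸k]!∣n!)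
open import Data.Nat.DivMod using (m/n*n≡m)
import Data.Nat.Properties as ℕₚ
import Data.Integer.Properties as ℤₚ
open import Data.Integer using (0ℤ; 1ℤ; -1ℤ; -_)
open import Data.Fin using (toℕ)
open import Data.Fin.Properties using (toℕ-inject₁; toℕ-fromℕ)
open import Algebra.Properties.Semiring.Sum ℤₚ.+-*-semiring
  using (sum; sum-cong-≗; ∑-distrib-+; ∑-comm; *-distribˡ-sum; *-distribʳ-sum; sum-init-last)
open import Data.Rational.Unnormalised as ℚᵘ using (mkℚᵘ; *≡*)
import Data.Rational.Unnormalised.Properties as ℚᵘₚ
import Data.Rational.Properties as ℚₚ
open import Data.Product using (_,_)
open import Function using (_∘_)
open import Relation.Binary.PropositionalEquality
  using (refl; sym; trans; cong; cong₂; subst; module ≡-Reasoning)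
import Data.Nat.Tactic.RingSolver as ℕ-Solver
import Data.Integer.Tactic.RingSolver as ℤ-Solver

Σ≤ : ℕ → (ℕ → ℤ) → ℤ
Σ≤ n f = sum {suc n} (f ∘ toℕ)

Σ≤-cong : ∀ n {f g : ℕ → ℤ} → (∀ k → f k ≡ g k) → Σ≤ n f ≡ Σ≤ n g
Σ≤-cong n f≗g = sum-cong-≗ {suc n} (f≗g ∘ toℕ)

Σ≤-distrib-+ : ∀ n (f g : ℕ → ℤ) → Σ≤ n (λ k → f k ℤ.+ g k) ≡ Σ≤ n f ℤ.+ Σ≤ n g
Σ≤-distrib-+ n f g = ∑-distrib-+ {suc n} (f ∘ toℕ) (g ∘ toℕ)

Σ≤-*ˡ : ∀ n (c : ℤ) (f : ℕ → ℤ) → Σ≤ n (λ k → c ℤ.* f k) ≡ c ℤ.* Σ≤ n f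
Σ≤-*ˡ n c f = sym (*-distribˡ-sum {suc n} c (f ∘ toℕ))

Σ≤-*ʳ : ∀ n (c : ℤ) (f : ℕ → ℤ) → Σ≤ n (λ k → f k ℤ.* c) ≡ Σ≤ n f ℤ.* c
Σ≤-*ʳ n c f = sym (*-distribʳ-sum {suc n} c (f ∘ toℕ))

Σ≤-comm : ∀ m n (f : ℕ → ℕ → ℤ) →
          Σ≤ m (λ j → Σ≤ n (f j)) ≡ Σ≤ n (λ k → Σ≤ m (λ j → f j k))
Σ≤-comm m n f = ∑-comm {suc m} {suc n} (λ i l → f (toℕ i) (toℕ l))

Σ≤-last : ∀ n (f : ℕ → ℤ) → Σ≤ (suc n) f ≡ Σ≤ n f ℤ.+ f (suc n)
Σ≤-last n f = trans (sum-init-last {suc n} (f ∘ toℕ))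
  (cong₂ ℤ._+_ (sum-cong-≗ {suc n} (cong f ∘ toℕ-inject₁)) (cong f (toℕ-fromℕ (suc n))))

Σ≤-vanishing-tail : ∀ m n (f : ℕ → ℤ) → (∀ k → f (suc m + k) ≡ 0ℤ) → Σ≤ (m + n) f ≡ Σ≤ m f
Σ≤-vanishing-tail m zero f tail≡0 = cong (λ l → Σ≤ l f) (ℕₚ.+-identityʳ m)
Σ≤-vanishing-tail m (suc n) f tail≡0 = begin
  Σ≤ (m + suc n) f           ≡⟨ cong (λ l → Σ≤ l f) (ℕₚ.+-suc m n) ⟩
  Σ≤ (suc (m + n)) f         ≡⟨ Σ≤-last (m + n) f ⟩
  Σ≤ (m + n) f ℤ.+ f (suc (m + n)) ≡⟨ cong₂ ℤ._+_ (Σ≤-vanishing-tail m n f tail≡0) (tail≡0 n) ⟩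
  Σ≤ m f ℤ.+ 0ℤ              ≡⟨ ℤₚ.+-identityʳ (Σ≤ m f) ⟩
  Σ≤ m f                     ∎
  where open ≡-Reasoning

sgn : ℕ → ℤ
sgn zero    = 1ℤ
sgn (suc k) = - sgn k

sgn-+ : ∀ k l → sgn (k + l) ≡ sgn k ℤ.* sgn l
sgn-+ zero    l = sym (ℤₚ.*-identityˡ (sgn l))
sgn-+ (suc k) l = trans (cong -_ (sgn-+ k l)) (ℤₚ.neg-distribˡ-* (sgn k) (sgn l))

sgn-*-sgn : ∀ k → sgn k ℤ.* sgn k ≡ 1ℤ
sgn-*-sgn zero    = refl
sgn-*-sgn (suc k) = trans (neg*neg (sgn k)) (sgn-*-sgn k)
  where
  neg*neg : ∀ x → - x ℤ.* - x ≡ x ℤ.* x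
  neg*neg = ℤ-Solver.solve-∀

[m+n]Cm*[m!*n!]≡[m+n]! : ∀ m n → ((m + n) C m) * (m ! * n !) ≡ (m + n) !
[m+n]Cm*[m!*n!]≡[m+n]! m n = subst (λ l → ((m + n) C m) * (m ! * l !) ≡ (m + n) !) (ℕₚ.m+n∸m≡n m n)
  (trans (cong (_* (m ! * (m + n ∸ m) !)) (nCk≡n!/k![n-k]! m≤m+n))
         (m/n*n≡m {{m ℕₚ.!* (m + n ∸ m) !≢0}} (k![n∸k]!∣n! m≤m+n)))
  where
  m≤m+n : m ≤ m + n
  m≤m+n = ℕₚ.m≤m+n m n

pascal : ∀ n k → suc n C suc k ≡ n C k + n C suc k
pascal n k = sym (nCk+nC[k+1]≡[n+1]C[k+1] n k)

nC[k+1]*[k+1]+nCk*k≡n*nCk : ∀ n k → (n C suc k) * suc k + (n C k) * k ≡ n * (n C k)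
nC[k+1]*[k+1]+nCk*k≡n*nCk n zero =
  trans (ℕₚ.+-identityʳ _) (trans (ℕₚ.*-identityʳ _) (trans (nC1≡n n) (sym (ℕₚ.*-identityʳ n))))
nC[k+1]*[k+1]+nCk*k≡n*nCk zero (suc k) = refl
nC[k+1]*[k+1]+nCk*k≡n*nCk (suc n) (suc k) = begin
  (suc n C suc (suc k)) * suc (suc k) + (suc n C suc k) * suc k
    ≡⟨ cong₂ (λ x y → x * suc (suc k) + y * suc k) (pascal n (suc k)) (pascal n k) ⟩
  (b + c) * suc (suc k) + (a + b) * suc k
    ≡⟨ regroup a b c k ⟩
  (c * suc (suc k) + b * suc k) + (b * suc k + a * k) + (a + b)
    ≡⟨ cong₂ (λ x y → x + y + (a + b)) (nC[k+1]*[k+1]+nCk*k≡n*nCk n (suc k)) (nC[k+1]*[k+1]+nCk*k≡n*nCk n k) ⟩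
  n * b + n * a + (a + b)
    ≡⟨ collect n a b ⟩
  suc n * (a + b)
    ≡⟨ cong (suc n *_) (sym (pascal n k)) ⟩
  suc n * (suc n C suc k) ∎
  where
  open ≡-Reasoning
  a = n C k
  b = n C suc k
  c = n C suc (suc k)
  regroup : ∀ a b c k → (b + c) * suc (suc k) + (a + b) * suc k
                      ≡ (c * suc (suc k) + b * suc k) + (b * suc k + a * k) + (a + b)
  regroup = ℕ-Solver.solve-∀
  collect : ∀ n a b → n * b + n * a + (a + b) ≡ suc n * (a + b)
  collect = ℕ-Solver.solve-∀

vandermonde : ∀ m j s → Σ≤ m (λ k → + ((m C k) * (j C (s + k)))) ≡ + ((m + j) C (s + m))
vandermonde zero    j s = trans (ℤₚ.+-identityʳ _) (cong +_ (ℕₚ.*-identityˡ (j C (s + 0))))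
vandermonde (suc m) j s = begin
  below 0 ℤ.+ Σ≤ m (λ k → + ((suc m C suc k) * (j C (s + suc k))))
    ≡⟨ cong (ℤ._+_ (below 0)) (trans (Σ≤-cong m pascal-split) (Σ≤-distrib-+ m lower upper)) ⟩
  below 0 ℤ.+ (Σ≤ m lower ℤ.+ Σ≤ m upper)
    ≡⟨ regroup (below 0) (Σ≤ m lower) (Σ≤ m upper) ⟩
  Σ≤ (suc m) below ℤ.+ Σ≤ m lower
    ≡⟨ cong₂ ℤ._+_ below-sum lower-sum ⟩
  + ((m + j) C (s + m)) ℤ.+ + ((m + j) C suc (s + m))
    ≡⟨ ℤₚ.pos-+ ((m + j) C (s + m)) ((m + j) C suc (s + m)) ⟨
  + ((m + j) C (s + m) + (m + j) C suc (s + m))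
    ≡⟨ cong +_ (trans (sym (pascal (m + j) (s + m))) (cong ((suc m + j) C_) (sym (ℕₚ.+-suc s m)))) ⟩
  + ((suc m + j) C (s + suc m)) ∎
  where
  open ≡-Reasoning
  below lower upper : ℕ → ℤ
  below k = + ((m C k) * (j C (s + k)))
  lower k = + ((m C k) * (j C (s + suc k)))
  upper k = + ((m C suc k) * (j C (s + suc k)))
  pascal-split : ∀ k → + ((suc m C suc k) * (j C (s + suc k))) ≡ lower k ℤ.+ upper k
  pascal-split k = begin
    + ((suc m C suc k) * J)            ≡⟨ cong (λ l → + (l * J)) (pascal m k) ⟩
    + ((m C k + m C suc k) * J)        ≡⟨ cong +_ (ℕₚ.*-distribʳ-+ J (m C k) (m C suc k)) ⟩
    + ((m C k) * J + (m C suc k) * J)  ≡⟨ ℤₚ.pos-+ ((m C k) * J) ((m C suc k) * J) ⟩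
    lower k ℤ.+ upper k                ∎
    where J = j C (s + suc k)
  regroup : ∀ a b c → a ℤ.+ (b ℤ.+ c) ≡ (a ℤ.+ c) ℤ.+ b
  regroup = ℤ-Solver.solve-∀
  below-sum : Σ≤ (suc m) below ≡ + ((m + j) C (s + m))
  below-sum = begin
    Σ≤ (suc m) below               ≡⟨ Σ≤-last m below ⟩
    Σ≤ m below ℤ.+ below (suc m)   ≡⟨ cong (λ l → Σ≤ m below ℤ.+ + (l * (j C (s + suc m))))
                                            (k>n⇒nCk≡0 (ℕₚ.n<1+n m)) ⟩
    Σ≤ m below ℤ.+ 0ℤ              ≡⟨ ℤₚ.+-identityʳ (Σ≤ m below) ⟩
    Σ≤ m below                     ≡⟨ vandermonde m j s ⟩
    + ((m + j) C (s + m))          ∎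
  lower-sum : Σ≤ m lower ≡ + ((m + j) C suc (s + m))
  lower-sum = trans (Σ≤-cong m (λ k → cong (λ l → + ((m C k) * (j C l))) (ℕₚ.+-suc s k)))
                    (vandermonde m j (suc s))

[j+α]Cj*α!≡[j+m+1]*m!*n!*[m+j]Cm*[j+α]Cn : ∀ m n j {α} → α ≡ suc (m + n) →
  ((j + α) C j) * α ! ≡ suc (j + m) * (m ! * n ! * (((m + j) C m) * ((j + α) C n)))
[j+α]Cj*α!≡[j+m+1]*m!*n!*[m+j]Cm*[j+α]Cn m n j {α} refl =
  ℕₚ.*-cancelʳ-≡ _ _ (j ! * (m + j) !) {{j ℕₚ.!* (m + j) !≢0}} (begin
    ((j + α) C j) * α ! * (j ! * (m + j) !)
      ≡⟨ regroupˡ ((j + α) C j) (α !) (j !) ((m + j) !) ⟩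
    (((j + α) C j) * (j ! * α !)) * (m + j) !
      ≡⟨ cong (_* (m + j) !) ([m+n]Cm*[m!*n!]≡[m+n]! j α) ⟩
    (j + α) ! * (m + j) !
      ≡⟨ cong₂ _*_ (sym [j+α]!) (sym ([m+n]Cm*[m!*n!]≡[m+n]! m j)) ⟩
    (C₂ * (n ! * (suc (m + j)) !)) * (C₁ * (m ! * j !))
      ≡⟨ cong (λ l → (C₂ * (n ! * (suc l * (m + j) !))) * (C₁ * (m ! * j !))) (ℕₚ.+-comm m j) ⟩
    (C₂ * (n ! * (suc (j + m) * (m + j) !))) * (C₁ * (m ! * j !))
      ≡⟨ regroupʳ (suc (j + m)) (m !) (n !) C₁ C₂ (j !) ((m + j) !) ⟨
    suc (j + m) * (m ! * n ! * (C₁ * C₂)) * (j ! * (m + j) !) ∎)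
  where
  open ≡-Reasoning
  C₁ = (m + j) C m
  C₂ = (j + α) C n
  regroupˡ : ∀ c a x y → c * a * (x * y) ≡ (c * (x * a)) * y
  regroupˡ = ℕ-Solver.solve-∀
  regroupʳ : ∀ s a b c₁ c₂ x y → s * (a * b * (c₁ * c₂)) * (x * y) ≡ (c₂ * (b * (s * y))) * (c₁ * (a * x))
  regroupʳ = ℕ-Solver.solve-∀
  n+[m+j+1]≡j+α : n + suc (m + j) ≡ j + α
  n+[m+j+1]≡j+α = shuffle n m j
    where
    shuffle : ∀ n m j → n + suc (m + j) ≡ j + suc (m + n)
    shuffle = ℕ-Solver.solve-∀
  [j+α]! : C₂ * (n ! * (suc (m + j)) !) ≡ (j + α) !
  [j+α]! = subst (λ l → (l C n) * (n ! * (suc (m + j)) !) ≡ l !) n+[m+j+1]≡j+α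
                 ([m+n]Cm*[m!*n!]≡[m+n]! n (suc (m + j)))

falling-pos : ∀ n j → falling (+ n) j ≡ + ((n C j) * j !)
falling-pos n zero    = refl
falling-pos n (suc j) = begin
  falling (+ n) j ℤ.* (+ n ℤ.- + j)            ≡⟨ cong (ℤ._* (+ n ℤ.- + j)) (falling-pos n j) ⟩
  + (c * j !) ℤ.* (+ n ℤ.- + j)                ≡⟨ cong (ℤ._* (+ n ℤ.- + j)) (ℤₚ.pos-* c (j !)) ⟩
  (+ c ℤ.* + (j !)) ℤ.* (+ n ℤ.- + j)          ≡⟨ regroup (+ c) (+ (j !)) (+ n) (+ j) ⟩
  (+ n ℤ.* + c ℤ.- + c ℤ.* + j) ℤ.* + (j !)    ≡⟨ cong (ℤ._* + (j !)) absorption ⟩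
  + ((n C suc j) * suc j) ℤ.* + (j !)          ≡⟨ ℤₚ.pos-* ((n C suc j) * suc j) (j !) ⟨
  + ((n C suc j) * suc j * j !)                ≡⟨ cong +_ (ℕₚ.*-assoc (n C suc j) (suc j) (j !)) ⟩
  + ((n C suc j) * (suc j * j !))              ∎
  where
  open ≡-Reasoning
  c = n C j
  regroup : ∀ c f n j → (c ℤ.* f) ℤ.* (n ℤ.- j) ≡ (n ℤ.* c ℤ.- c ℤ.* j) ℤ.* f
  regroup = ℤ-Solver.solve-∀
  cancel : ∀ x y → (x ℤ.+ y) ℤ.- y ≡ x
  cancel = ℤ-Solver.solve-∀
  absorption : + n ℤ.* + c ℤ.- + c ℤ.* + j ≡ + ((n C suc j) * suc j)
  absorption = begin
    + n ℤ.* + c ℤ.- + c ℤ.* + j        ≡⟨ cong₂ ℤ._-_ (ℤₚ.pos-* n c) (ℤₚ.pos-* c j) ⟨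
    + (n * c) ℤ.- + (c * j)            ≡⟨ cong (λ x → + x ℤ.- + (c * j)) (nC[k+1]*[k+1]+nCk*k≡n*nCk n j) ⟨
    + ((n C suc j) * suc j + c * j) ℤ.- + (c * j)
                                       ≡⟨ cong (ℤ._- + (c * j)) (ℤₚ.pos-+ ((n C suc j) * suc j) (c * j)) ⟩
    (+ ((n C suc j) * suc j) ℤ.+ + (c * j)) ℤ.- + (c * j)
                                       ≡⟨ cancel (+ ((n C suc j) * suc j)) (+ (c * j)) ⟩
    + ((n C suc j) * suc j)            ∎

falling-neg-*-! : ∀ α j → falling -[1+ α ] j ℤ.* + (α !) ≡ sgn j ℤ.* + ((j + α) !)
falling-neg-*-! α zero    = refl
falling-neg-*-! α (suc j) = begin
  (falling -[1+ α ] j ℤ.* (-[1+ α ] ℤ.- + j)) ℤ.* + (α !)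
    ≡⟨ swap (falling -[1+ α ] j) (-[1+ α ] ℤ.- + j) (+ (α !)) ⟩
  (falling -[1+ α ] j ℤ.* + (α !)) ℤ.* (-[1+ α ] ℤ.- + j)
    ≡⟨ cong₂ ℤ._*_ (falling-neg-*-! α j) next-factor ⟩
  (sgn j ℤ.* + ((j + α) !)) ℤ.* - + suc (j + α)
    ≡⟨ regroup (sgn j) (+ ((j + α) !)) (+ suc (j + α)) ⟩
  - sgn j ℤ.* (+ suc (j + α) ℤ.* + ((j + α) !))
    ≡⟨ cong (- sgn j ℤ.*_) (ℤₚ.pos-* (suc (j + α)) ((j + α) !)) ⟨
  - sgn j ℤ.* + ((suc j + α) !) ∎
  where
  open ≡-Reasoning
  swap : ∀ f d a → (f ℤ.* d) ℤ.* a ≡ (f ℤ.* a) ℤ.* d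
  swap = ℤ-Solver.solve-∀
  regroup : ∀ s F x → (s ℤ.* F) ℤ.* - x ≡ - s ℤ.* (x ℤ.* F)
  regroup = ℤ-Solver.solve-∀
  next-factor : -[1+ α ] ℤ.- + j ≡ - + suc (j + α)
  next-factor = trans (sym (ℤₚ.neg-distrib-+ (+ suc α) (+ j)))
                      (cong (λ l → - + l) (trans (ℕₚ.+-comm (suc α) j) (ℕₚ.+-suc j α)))

falling-neg : ∀ α j → falling -[1+ α ] j ≡ sgn j ℤ.* + (((j + α) C j) * j !)
falling-neg α j = ℤₚ.*-cancelʳ-≡ _ _ (+ (α !)) {{α ℕₚ.!≢0}} (begin
  falling -[1+ α ] j ℤ.* + (α !)        ≡⟨ falling-neg-*-! α j ⟩
  sgn j ℤ.* + ((j + α) !)               ≡⟨ cong (λ l → sgn j ℤ.* + l) ([m+n]Cm*[m!*n!]≡[m+n]! j α) ⟨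
  sgn j ℤ.* + (A * (j ! * α !))         ≡⟨ cong (λ l → sgn j ℤ.* + l) (ℕₚ.*-assoc A (j !) (α !)) ⟨
  sgn j ℤ.* + (A * j ! * α !)           ≡⟨ cong (sgn j ℤ.*_) (ℤₚ.pos-* (A * j !) (α !)) ⟩
  sgn j ℤ.* (+ (A * j !) ℤ.* + (α !))   ≡⟨ ℤₚ.*-assoc (sgn j) (+ (A * j !)) (+ (α !)) ⟨
  sgn j ℤ.* + (A * j !) ℤ.* + (α !)     ∎)
  where
  open ≡-Reasoning
  A = (j + α) C j

-- Δ n g is (−1)ⁿ times the n-th forward difference of g at 0.
Δ : ℕ → (ℕ → ℤ) → ℤ
Δ n g = Σ≤ n (λ j → sgn j ℤ.* (+ (n C j) ℤ.* g j))

Δ-cong : ∀ n {g h : ℕ → ℤ} → (∀ j → g j ≡ h j) → Δ n g ≡ Δ n h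
Δ-cong n g≗h = Σ≤-cong n (λ j → cong (λ x → sgn j ℤ.* (+ (n C j) ℤ.* x)) (g≗h j))

Δ-*ˡ : ∀ n c g → Δ n (λ j → c ℤ.* g j) ≡ c ℤ.* Δ n g
Δ-*ˡ n c g = trans (Σ≤-cong n (λ j → swap (sgn j) (+ (n C j)) c (g j)))
                   (Σ≤-*ˡ n c (λ j → sgn j ℤ.* (+ (n C j) ℤ.* g j)))
  where
  swap : ∀ s a c x → s ℤ.* (a ℤ.* (c ℤ.* x)) ≡ c ℤ.* (s ℤ.* (a ℤ.* x))
  swap = ℤ-Solver.solve-∀

Δ-distrib-+ : ∀ n g h → Δ n (λ j → g j ℤ.+ h j) ≡ Δ n g ℤ.+ Δ n h
Δ-distrib-+ n g h = trans (Σ≤-cong n (λ j → distrib (sgn j) (+ (n C j)) (g j) (h j)))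
                          (Σ≤-distrib-+ n (λ j → sgn j ℤ.* (+ (n C j) ℤ.* g j))
                                          (λ j → sgn j ℤ.* (+ (n C j) ℤ.* h j)))
  where
  distrib : ∀ s a x y → s ℤ.* (a ℤ.* (x ℤ.+ y)) ≡ s ℤ.* (a ℤ.* x) ℤ.+ s ℤ.* (a ℤ.* y)
  distrib = ℤ-Solver.solve-∀

Δ-Σ≤ : ∀ n m (f : ℕ → ℕ → ℤ) → Δ n (λ j → Σ≤ m (λ k → f k j)) ≡ Σ≤ m (λ k → Δ n (f k))
Δ-Σ≤ n m f = trans (Σ≤-cong n (λ j → sym (trans (Σ≤-*ˡ m (sgn j) (λ k → + (n C j) ℤ.* f k j))
                                                 (cong (sgn j ℤ.*_) (Σ≤-*ˡ m (+ (n C j)) (λ k → f k j))))))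
                   (Σ≤-comm n m (λ j k → sgn j ℤ.* (+ (n C j) ℤ.* f k j)))

Δ-suc : ∀ n g → Δ (suc n) g ≡ Δ n g ℤ.- Δ n (g ∘ suc)
Δ-suc n g = begin
  Δ (suc n) g
    ≡⟨ cong (ℤ._+_ (t 0)) (Σ≤-cong n pascal-step) ⟩
  t 0 ℤ.+ Σ≤ n (λ j → -1ℤ ℤ.* u j ℤ.+ t (suc j))
    ≡⟨ cong (ℤ._+_ (t 0)) (Σ≤-distrib-+ n (λ j → -1ℤ ℤ.* u j) (t ∘ suc)) ⟩
  t 0 ℤ.+ (Σ≤ n (λ j → -1ℤ ℤ.* u j) ℤ.+ Σ≤ n (t ∘ suc))
    ≡⟨ cong (λ x → t 0 ℤ.+ (x ℤ.+ Σ≤ n (t ∘ suc))) (Σ≤-*ˡ n -1ℤ u) ⟩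
  t 0 ℤ.+ (-1ℤ ℤ.* Δ n (g ∘ suc) ℤ.+ Σ≤ n (t ∘ suc))
    ≡⟨ regroup (t 0) (Δ n (g ∘ suc)) (Σ≤ n (t ∘ suc)) ⟩
  Σ≤ (suc n) t ℤ.- Δ n (g ∘ suc)
    ≡⟨ cong (ℤ._- Δ n (g ∘ suc)) (Σ≤-last n t) ⟩
  (Δ n g ℤ.+ t (suc n)) ℤ.- Δ n (g ∘ suc)
    ≡⟨ cong (λ x → (Δ n g ℤ.+ x) ℤ.- Δ n (g ∘ suc)) last≡0 ⟩
  (Δ n g ℤ.+ 0ℤ) ℤ.- Δ n (g ∘ suc)
    ≡⟨ cong (ℤ._- Δ n (g ∘ suc)) (ℤₚ.+-identityʳ (Δ n g)) ⟩
  Δ n g ℤ.- Δ n (g ∘ suc) ∎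
  where
  open ≡-Reasoning
  t u : ℕ → ℤ
  t j = sgn j ℤ.* (+ (n C j) ℤ.* g j)
  u j = sgn j ℤ.* (+ (n C j) ℤ.* g (suc j))
  last≡0 : t (suc n) ≡ 0ℤ
  last≡0 = trans (cong (λ c → sgn (suc n) ℤ.* (+ c ℤ.* g (suc n))) (k>n⇒nCk≡0 (ℕₚ.n<1+n n)))
                 (ℤₚ.*-zeroʳ (sgn (suc n)))
  split : ∀ s a b x → - s ℤ.* ((a ℤ.+ b) ℤ.* x) ≡ -1ℤ ℤ.* (s ℤ.* (a ℤ.* x)) ℤ.+ - s ℤ.* (b ℤ.* x)
  split = ℤ-Solver.solve-∀
  pascal-step : ∀ j → sgn (suc j) ℤ.* (+ (suc n C suc j) ℤ.* g (suc j)) ≡ -1ℤ ℤ.* u j ℤ.+ t (suc j)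
  pascal-step j = begin
    sgn (suc j) ℤ.* (+ (suc n C suc j) ℤ.* g (suc j))
      ≡⟨ cong (λ c → sgn (suc j) ℤ.* (+ c ℤ.* g (suc j))) (pascal n j) ⟩
    sgn (suc j) ℤ.* (+ (n C j + n C suc j) ℤ.* g (suc j))
      ≡⟨ cong (λ c → sgn (suc j) ℤ.* (c ℤ.* g (suc j))) (ℤₚ.pos-+ (n C j) (n C suc j)) ⟩
    sgn (suc j) ℤ.* ((+ (n C j) ℤ.+ + (n C suc j)) ℤ.* g (suc j))
      ≡⟨ split (sgn j) (+ (n C j)) (+ (n C suc j)) (g (suc j)) ⟩
    -1ℤ ℤ.* u j ℤ.+ t (suc j) ∎
  regroup : ∀ x d s → x ℤ.+ (-1ℤ ℤ.* d ℤ.+ s) ≡ (x ℤ.+ s) ℤ.- d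
  regroup = ℤ-Solver.solve-∀

Δ-suc-difference : ∀ n (g h : ℕ → ℤ) → (∀ j → g (suc j) ≡ h j ℤ.+ g j) → Δ (suc n) g ≡ - Δ n h
Δ-suc-difference n g h g∘suc≡h+g = begin
  Δ (suc n) g                                ≡⟨ Δ-suc n g ⟩
  Δ n g ℤ.- Δ n (g ∘ suc)                    ≡⟨ cong (ℤ._-_ (Δ n g)) (Δ-cong n g∘suc≡h+g) ⟩
  Δ n g ℤ.- Δ n (λ j → h j ℤ.+ g j)          ≡⟨ cong (ℤ._-_ (Δ n g)) (Δ-distrib-+ n h g) ⟩
  Δ n g ℤ.- (Δ n h ℤ.+ Δ n g)                ≡⟨ cancel (Δ n g) (Δ n h) ⟩
  - Δ n h                                    ∎
  where
  open ≡-Reasoning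
  cancel : ∀ x y → x ℤ.- (y ℤ.+ x) ≡ - y
  cancel = ℤ-Solver.solve-∀

binomProduct : ℕ → ℕ → ℕ → ℕ → ℤ
binomProduct k c p j = + ((j C k) * ((j + c) C p))

binomProduct-0-suc : ∀ c p j → binomProduct 0 c (suc p) (suc j) ≡ binomProduct 0 c p j ℤ.+ binomProduct 0 c (suc p) j
binomProduct-0-suc c p j = begin
  + (1 * (suc (j + c) C suc p))  ≡⟨ cong (λ l → + (1 * l)) (pascal (j + c) p) ⟩
  + (1 * (x + y))                ≡⟨ cong +_ (distrib x y) ⟩
  + (1 * x + 1 * y)              ≡⟨ ℤₚ.pos-+ (1 * x) (1 * y) ⟩
  + (1 * x) ℤ.+ + (1 * y)        ∎
  where
  open ≡-Reasoning
  x = (j + c) C p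
  y = (j + c) C suc p
  distrib : ∀ x y → 1 * (x + y) ≡ 1 * x + 1 * y
  distrib = ℕ-Solver.solve-∀

binomProduct-suc-suc : ∀ k c p j → binomProduct (suc k) c (suc p) (suc j) ≡
  binomProduct k (suc c) (suc p) j ℤ.+ binomProduct (suc k) c p j ℤ.+ binomProduct (suc k) c (suc p) j
binomProduct-suc-suc k c p j = begin
  + ((suc j C suc k) * ((suc j + c) C suc p))
    ≡⟨ cong₂ (λ x y → + (x * y)) (pascal j k) (pascal (j + c) p) ⟩
  + ((a + b) * (x + y))
    ≡⟨ cong +_ (expand a b x y) ⟩
  + (a * (x + y) + b * x + b * y)
    ≡⟨ ℤₚ.pos-+ (a * (x + y) + b * x) (b * y) ⟩
  + (a * (x + y) + b * x) ℤ.+ + (b * y)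
    ≡⟨ cong (ℤ._+ + (b * y)) (ℤₚ.pos-+ (a * (x + y)) (b * x)) ⟩
  + (a * (x + y)) ℤ.+ + (b * x) ℤ.+ + (b * y)
    ≡⟨ cong (λ l → + (a * l) ℤ.+ + (b * x) ℤ.+ + (b * y)) (pascal (j + c) p) ⟨
  + (a * (suc (j + c) C suc p)) ℤ.+ + (b * x) ℤ.+ + (b * y)
    ≡⟨ cong (λ l → + (a * (l C suc p)) ℤ.+ + (b * x) ℤ.+ + (b * y)) (ℕₚ.+-suc j c) ⟨
  binomProduct k (suc c) (suc p) j ℤ.+ binomProduct (suc k) c p j ℤ.+ binomProduct (suc k) c (suc p) j ∎
  where
  open ≡-Reasoning
  a = j C k
  b = j C suc k
  x = (j + c) C p
  y = (j + c) C suc p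
  expand : ∀ a b x y → (a + b) * (x + y) ≡ a * (x + y) + b * x + b * y
  expand = ℕ-Solver.solve-∀

Δ-binomProduct : ∀ n k c q → Δ n (binomProduct k c (q + n)) ≡ sgn n ℤ.* + ((n C k) * ((k + c) C (q + k)))
Δ-binomProduct zero    zero    c q = base (+ ((0 C 0) * (c C (q + 0))))
  where
  base : ∀ x → 1ℤ ℤ.* (1ℤ ℤ.* x) ℤ.+ 0ℤ ≡ 1ℤ ℤ.* x
  base = ℤ-Solver.solve-∀
Δ-binomProduct zero    (suc k) c q = refl
Δ-binomProduct (suc n) zero    c q rewrite ℕₚ.+-suc q n = begin
  Δ (suc n) (binomProduct 0 c (suc q + n))
    ≡⟨ Δ-suc-difference n (binomProduct 0 c (suc q + n)) (binomProduct 0 c (q + n)) (binomProduct-0-suc c (q + n)) ⟩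
  - Δ n (binomProduct 0 c (q + n))          ≡⟨ cong -_ (Δ-binomProduct n 0 c q) ⟩
  - (sgn n ℤ.* + ((n C 0) * (c C (q + 0)))) ≡⟨ ℤₚ.neg-distribˡ-* (sgn n) _ ⟩
  - sgn n ℤ.* + ((n C 0) * (c C (q + 0)))   ∎
  where open ≡-Reasoning
Δ-binomProduct (suc n) (suc k) c q rewrite ℕₚ.+-suc q n = begin
  Δ (suc n) (binomProduct (suc k) c (suc q + n))
    ≡⟨ Δ-suc-difference n (binomProduct (suc k) c (suc q + n))
                          (λ j → binomProduct k (suc c) (suc q + n) j ℤ.+ binomProduct (suc k) c (q + n) j)
                          (binomProduct-suc-suc k c (q + n)) ⟩
  - Δ n (λ j → binomProduct k (suc c) (suc q + n) j ℤ.+ binomProduct (suc k) c (q + n) j)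
    ≡⟨ cong -_ (Δ-distrib-+ n (binomProduct k (suc c) (suc q + n)) (binomProduct (suc k) c (q + n))) ⟩
  - (Δ n (binomProduct k (suc c) (suc q + n)) ℤ.+ Δ n (binomProduct (suc k) c (q + n)))
    ≡⟨ cong -_ (cong₂ ℤ._+_ (Δ-binomProduct n k (suc c) (suc q)) (Δ-binomProduct n (suc k) c q)) ⟩
  - (sgn n ℤ.* + ((n C k) * ((k + suc c) C (suc q + k))) ℤ.+ sgn n ℤ.* + ((n C suc k) * Z))
    ≡⟨ cong (λ l → - (sgn n ℤ.* + ((n C k) * l) ℤ.+ sgn n ℤ.* + ((n C suc k) * Z)))
            (cong₂ _C_ (ℕₚ.+-suc k c) (sym (ℕₚ.+-suc q k))) ⟩
  - (sgn n ℤ.* + ((n C k) * Z) ℤ.+ sgn n ℤ.* + ((n C suc k) * Z))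
    ≡⟨ cong -_ (pascal-combine (sgn n)) ⟩
  - (sgn n ℤ.* + ((suc n C suc k) * Z))
    ≡⟨ ℤₚ.neg-distribˡ-* (sgn n) (+ ((suc n C suc k) * Z)) ⟩
  - sgn n ℤ.* + ((suc n C suc k) * Z) ∎
  where
  open ≡-Reasoning
  Z = (suc k + c) C (q + suc k)
  pascal-combine : ∀ s → s ℤ.* + ((n C k) * Z) ℤ.+ s ℤ.* + ((n C suc k) * Z) ≡ s ℤ.* + ((suc n C suc k) * Z)
  pascal-combine s = begin
    s ℤ.* + (a * Z) ℤ.+ s ℤ.* + (b * Z)  ≡⟨ ℤₚ.*-distribˡ-+ s (+ (a * Z)) (+ (b * Z)) ⟨
    s ℤ.* (+ (a * Z) ℤ.+ + (b * Z))      ≡⟨ cong (s ℤ.*_) (ℤₚ.pos-+ (a * Z) (b * Z)) ⟨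
    s ℤ.* + (a * Z + b * Z)              ≡⟨ cong (λ l → s ℤ.* + l) (ℕₚ.*-distribʳ-+ Z a b) ⟨
    s ℤ.* + ((a + b) * Z)                ≡⟨ cong (λ l → s ℤ.* + (l * Z)) (pascal n k) ⟨
    s ℤ.* + ((suc n C suc k) * Z)        ∎
    where
    a = n C k
    b = n C suc k

binomTripleSum : ℕ → ℕ → ℕ → ℤ
binomTripleSum m n N = Σ≤ m (λ k → + ((m C k) * (n C k) * ((k + N) C k)))

binomTripleSum-comm : ∀ m n N → binomTripleSum m n N ≡ binomTripleSum n m N
binomTripleSum-comm m n N = begin
  Σ≤ m t        ≡⟨ Σ≤-vanishing-tail m n t beyond-m ⟨
  Σ≤ (m + n) t  ≡⟨ cong (λ l → Σ≤ l t) (ℕₚ.+-comm m n) ⟩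
  Σ≤ (n + m) t  ≡⟨ Σ≤-vanishing-tail n m t beyond-n ⟩
  Σ≤ n t        ≡⟨ Σ≤-cong n (λ k → cong (λ l → + (l * ((k + N) C k))) (ℕₚ.*-comm (m C k) (n C k))) ⟩
  binomTripleSum n m N ∎
  where
  open ≡-Reasoning
  t : ℕ → ℤ
  t k = + ((m C k) * (n C k) * ((k + N) C k))
  C-beyond : ∀ a k → a C (suc a + k) ≡ 0
  C-beyond a k = k>n⇒nCk≡0 (s≤s (ℕₚ.m≤m+n a k))
  beyond-m : ∀ k → t (suc m + k) ≡ 0ℤ
  beyond-m k rewrite C-beyond m k = refl
  beyond-n : ∀ k → t (suc n + k) ≡ 0ℤ
  beyond-n k rewrite C-beyond n k | ℕₚ.*-zeroʳ (m C (suc n + k)) = refl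

Δ-binomial-binomial : ∀ m n N → Δ n (λ j → + (((m + j) C m) * ((j + N) C n))) ≡ sgn n ℤ.* binomTripleSum m n N
Δ-binomial-binomial m n N = begin
  Δ n (λ j → + (((m + j) C m) * ((j + N) C n)))
    ≡⟨ Δ-cong n expand ⟩
  Δ n (λ j → Σ≤ m (λ k → + (m C k) ℤ.* binomProduct k N n j))
    ≡⟨ Δ-Σ≤ n m (λ k j → + (m C k) ℤ.* binomProduct k N n j) ⟩
  Σ≤ m (λ k → Δ n (λ j → + (m C k) ℤ.* binomProduct k N n j))
    ≡⟨ Σ≤-cong m (λ k → Δ-*ˡ n (+ (m C k)) (binomProduct k N n)) ⟩
  Σ≤ m (λ k → + (m C k) ℤ.* Δ n (binomProduct k N n))
    ≡⟨ Σ≤-cong m (λ k → cong (+ (m C k) ℤ.*_) (Δ-binomProduct n k N 0)) ⟩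
  Σ≤ m (λ k → + (m C k) ℤ.* (sgn n ℤ.* + ((n C k) * ((k + N) C k))))
    ≡⟨ Σ≤-cong m (λ k → sign-out (m C k) (n C k) ((k + N) C k)) ⟩
  Σ≤ m (λ k → sgn n ℤ.* + ((m C k) * (n C k) * ((k + N) C k)))
    ≡⟨ Σ≤-*ˡ m (sgn n) (λ k → + ((m C k) * (n C k) * ((k + N) C k))) ⟩
  sgn n ℤ.* binomTripleSum m n N ∎
  where
  open ≡-Reasoning
  expand : ∀ j → + (((m + j) C m) * ((j + N) C n)) ≡ Σ≤ m (λ k → + (m C k) ℤ.* binomProduct k N n j)
  expand j = begin
    + (((m + j) C m) * X)                         ≡⟨ ℤₚ.pos-* ((m + j) C m) X ⟩
    + ((m + j) C m) ℤ.* + X                       ≡⟨ cong (ℤ._* + X) (vandermonde m j 0) ⟨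
    Σ≤ m (λ k → + ((m C k) * (j C k))) ℤ.* + X    ≡⟨ Σ≤-*ʳ m (+ X) (λ k → + ((m C k) * (j C k))) ⟨
    Σ≤ m (λ k → + ((m C k) * (j C k)) ℤ.* + X)    ≡⟨ Σ≤-cong m (λ k → reassoc (m C k) (j C k)) ⟩
    Σ≤ m (λ k → + (m C k) ℤ.* binomProduct k N n j) ∎
    where
    X = (j + N) C n
    reassoc : ∀ a b → + (a * b) ℤ.* + X ≡ + a ℤ.* + (b * X)
    reassoc a b = trans (sym (ℤₚ.pos-* (a * b) X)) (trans (cong +_ (ℕₚ.*-assoc a b X)) (ℤₚ.pos-* a (b * X)))
  sign-out : ∀ a b c → + a ℤ.* (sgn n ℤ.* + (b * c)) ≡ sgn n ℤ.* + (a * b * c)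
  sign-out a b c = trans (ℤₚ.*-comm (+ a) (sgn n ℤ.* + (b * c)))
    (trans (ℤₚ.*-assoc (sgn n) (+ (b * c)) (+ a))
      (cong (sgn n ℤ.*_) (trans (sym (ℤₚ.pos-* (b * c) a)) (cong +_ (trans (ℕₚ.*-comm (b * c) a) (sym (ℕₚ.*-assoc a b c)))))))

toℚᵘ-/ : ∀ i n .{{_ : NonZero n}} → ℚ.toℚᵘ (i ℚ./ n) ℚᵘ.≃ mkℚᵘ i (pred n)
toℚᵘ-/ i (suc n) = ℚₚ.toℚᵘ-fromℚᵘ (mkℚᵘ i n)

/-cross : ∀ i k m n .{{_ : NonZero m}} .{{_ : NonZero n}} → i ℤ.* + n ≡ k ℤ.* + m → i ℚ./ m ≡ k ℚ./ n
/-cross i k m@(suc _) n@(suc _) eq =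
  ℚₚ.toℚᵘ-injective (ℚᵘₚ.≃-trans (toℚᵘ-/ i m) (ℚᵘₚ.≃-trans (*≡* eq) (ℚᵘₚ.≃-sym (toℚᵘ-/ k n))))

/-*-/ : ∀ i k m n .{{_ : NonZero m}} .{{_ : NonZero n}} →
        (i ℚ./ m) ℚ.* (k ℚ./ n) ≡ ((i ℤ.* k) ℚ./ (m * n)) {{ℕₚ.m*n≢0 m n}}
/-*-/ i k m@(suc _) n@(suc _) = ℚₚ.toℚᵘ-injective (ℚᵘₚ.≃-trans (ℚₚ.toℚᵘ-homo-* (i ℚ./ m) (k ℚ./ n))
  (ℚᵘₚ.≃-trans (ℚᵘₚ.*-cong (toℚᵘ-/ i m) (toℚᵘ-/ k n)) (ℚᵘₚ.≃-sym (toℚᵘ-/ (i ℤ.* k) (m * n)))))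

/-+-/ : ∀ i k d .{{_ : NonZero d}} → (i ℚ./ d) ℚ.+ (k ℚ./ d) ≡ (i ℤ.+ k) ℚ./ d
/-+-/ i k d@(suc _) = ℚₚ.toℚᵘ-injective (ℚᵘₚ.≃-trans (ℚₚ.toℚᵘ-homo-+ (i ℚ./ d) (k ℚ./ d))
  (ℚᵘₚ.≃-trans (ℚᵘₚ.+-cong (toℚᵘ-/ i d) (toℚᵘ-/ k d))
    (ℚᵘₚ.≃-trans (*≡* (trans (common-denominator i k (+ d)) (cong ((i ℤ.+ k) ℤ.*_) (sym (ℤₚ.pos-* d d)))))
      (ℚᵘₚ.≃-sym (toℚᵘ-/ (i ℤ.+ k) d)))))
  where
  common-denominator : ∀ i k d → (i ℤ.* d ℤ.+ k ℤ.* d) ℤ.* d ≡ (i ℤ.+ k) ℤ.* (d ℤ.* d)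
  common-denominator = ℤ-Solver.solve-∀

neg-/ : ∀ i d .{{_ : NonZero d}} → ℚ.- (i ℚ./ d) ≡ (- i) ℚ./ d
neg-/ i d@(suc _) = ℚₚ.toℚᵘ-injective (ℚᵘₚ.≃-trans (ℚₚ.toℚᵘ-homo‿- (i ℚ./ d))
  (ℚᵘₚ.≃-trans (ℚᵘₚ.-‿cong (toℚᵘ-/ i d)) (ℚᵘₚ.≃-sym (toℚᵘ-/ (- i) d))))

signPow-*-/ : ∀ k i d .{{_ : NonZero d}} → signPow k ℚ.* (i ℚ./ d) ≡ (sgn k ℤ.* i) ℚ./ d
signPow-*-/ zero    i d = trans (ℚₚ.*-identityˡ (i ℚ./ d)) (cong (ℚ._/ d) (sym (ℤₚ.*-identityˡ i)))
signPow-*-/ (suc k) i d = begin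
  ℚ.- signPow k ℚ.* (i ℚ./ d)    ≡⟨ ℚₚ.neg-distribˡ-* (signPow k) (i ℚ./ d) ⟨
  ℚ.- (signPow k ℚ.* (i ℚ./ d))  ≡⟨ cong ℚ.-_ (signPow-*-/ k i d) ⟩
  ℚ.- ((sgn k ℤ.* i) ℚ./ d)      ≡⟨ neg-/ (sgn k ℤ.* i) d ⟩
  (- (sgn k ℤ.* i)) ℚ./ d        ≡⟨ cong (ℚ._/ d) (ℤₚ.neg-distribˡ-* (sgn k) i) ⟩
  (- sgn k ℤ.* i) ℚ./ d          ∎
  where open ≡-Reasoning

sumTo-cong : ∀ n {f g : ℕ → ℚ} → (∀ j → f j ≡ g j) → sumTo n f ≡ sumTo n g
sumTo-cong zero    f≗g = f≗g 0
sumTo-cong (suc n) f≗g = cong₂ ℚ._+_ (sumTo-cong n f≗g) (f≗g (suc n))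

sumTo-*ˡ : ∀ n c (f : ℕ → ℚ) → sumTo n (λ j → c ℚ.* f j) ≡ c ℚ.* sumTo n f
sumTo-*ˡ zero    c f = refl
sumTo-*ˡ (suc n) c f = trans (cong (ℚ._+ c ℚ.* f (suc n)) (sumTo-*ˡ n c f))
                             (sym (ℚₚ.*-distribˡ-+ c (sumTo n f) (f (suc n))))

sumTo-/ : ∀ n (f : ℕ → ℤ) d .{{_ : NonZero d}} → sumTo n (λ j → f j ℚ./ d) ≡ Σ≤ n f ℚ./ d
sumTo-/ zero    f d = cong (ℚ._/ d) (sym (ℤₚ.+-identityʳ (f 0)))
sumTo-/ (suc n) f d = begin
  sumTo n (λ j → f j ℚ./ d) ℚ.+ f (suc n) ℚ./ d  ≡⟨ cong (ℚ._+ f (suc n) ℚ./ d) (sumTo-/ n f d) ⟩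
  Σ≤ n f ℚ./ d ℚ.+ f (suc n) ℚ./ d              ≡⟨ /-+-/ (Σ≤ n f) (f (suc n)) d ⟩
  (Σ≤ n f ℤ.+ f (suc n)) ℚ./ d                  ≡⟨ cong (ℚ._/ d) (Σ≤-last n f) ⟨
  Σ≤ (suc n) f ℚ./ d                            ∎
  where open ≡-Reasoning

falling-*-falling : ∀ m n j {α} → α ≡ suc (m + n) →
  falling -[1+ α ] j ℤ.* falling (+ n) j ℤ.* + (α !)
    ≡ (+ (m ! * n !) ℤ.* (sgn j ℤ.* (+ (n C j) ℤ.* + (((m + j) C m) * ((j + α) C n))))) ℤ.* + (suc (j + m) * j ! * j !)
falling-*-falling m n j {α} α≡ = begin
  falling -[1+ α ] j ℤ.* falling (+ n) j ℤ.* + (α !)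
    ≡⟨ cong₂ (λ x y → x ℤ.* y ℤ.* + (α !))
             (trans (falling-neg α j) (cong (s ℤ.*_) (ℤₚ.pos-* ((j + α) C j) (j !))))
             (trans (falling-pos n j) (ℤₚ.pos-* (n C j) (j !))) ⟩
  s ℤ.* (a ℤ.* J) ℤ.* (b ℤ.* J) ℤ.* + (α !)
    ≡⟨ regroupˡ s a b J (+ (α !)) ⟩
  (s ℤ.* b ℤ.* J ℤ.* J) ℤ.* (a ℤ.* + (α !))
    ≡⟨ cong ((s ℤ.* b ℤ.* J ℤ.* J) ℤ.*_) a*α!≡D*[P*Q] ⟩
  (s ℤ.* b ℤ.* J ℤ.* J) ℤ.* (D ℤ.* (P ℤ.* Q))
    ≡⟨ regroupʳ s b J D P Q ⟩
  (P ℤ.* (s ℤ.* (b ℤ.* Q))) ℤ.* (D ℤ.* J ℤ.* J)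
    ≡⟨ cong ((P ℤ.* (s ℤ.* (b ℤ.* Q))) ℤ.*_) (cong (ℤ._* J) (ℤₚ.pos-* (suc (j + m)) (j !))) ⟨
  (P ℤ.* (s ℤ.* (b ℤ.* Q))) ℤ.* (+ (suc (j + m) * j !) ℤ.* J)
    ≡⟨ cong ((P ℤ.* (s ℤ.* (b ℤ.* Q))) ℤ.*_) (ℤₚ.pos-* (suc (j + m) * j !) (j !)) ⟨
  (P ℤ.* (s ℤ.* (b ℤ.* Q))) ℤ.* + (suc (j + m) * j ! * j !) ∎
  where
  open ≡-Reasoning
  s = sgn j
  a = + ((j + α) C j)
  b = + (n C j)
  J = + (j !)
  D = + suc (j + m)
  P = + (m ! * n !)
  Q = + (((m + j) C m) * ((j + α) C n))
  a*α!≡D*[P*Q] : a ℤ.* + (α !) ≡ D ℤ.* (P ℤ.* Q)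
  a*α!≡D*[P*Q] = begin
    a ℤ.* + (α !)                                                    ≡⟨ ℤₚ.pos-* ((j + α) C j) (α !) ⟨
    + (((j + α) C j) * α !)                                          ≡⟨ cong +_ ([j+α]Cj*α!≡[j+m+1]*m!*n!*[m+j]Cm*[j+α]Cn m n j α≡) ⟩
    + (suc (j + m) * (m ! * n ! * (((m + j) C m) * ((j + α) C n))))  ≡⟨ ℤₚ.pos-* (suc (j + m)) _ ⟩
    D ℤ.* + (m ! * n ! * (((m + j) C m) * ((j + α) C n)))            ≡⟨ cong (D ℤ.*_) (ℤₚ.pos-* (m ! * n !) _) ⟩
    D ℤ.* (P ℤ.* Q)                                                  ∎
  regroupˡ : ∀ s a b J F → s ℤ.* (a ℤ.* J) ℤ.* (b ℤ.* J) ℤ.* F ≡ (s ℤ.* b ℤ.* J ℤ.* J) ℤ.* (a ℤ.* F)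
  regroupˡ = ℤ-Solver.solve-∀
  regroupʳ : ∀ s b J D P Q →
             (s ℤ.* b ℤ.* J ℤ.* J) ℤ.* (D ℤ.* (P ℤ.* Q)) ≡ (P ℤ.* (s ℤ.* (b ℤ.* Q))) ℤ.* (D ℤ.* J ℤ.* J)
  regroupʳ = ℤ-Solver.solve-∀

summand-as-fraction : ∀ m n j {α} → α ≡ suc (m + n) →
  (+ 1 ℚ./ suc (j + m)) ℚ.* binom -[1+ α ] j ℚ.* binom (+ n) j
    ≡ ((+ (m ! * n !) ℤ.* (sgn j ℤ.* (+ (n C j) ℤ.* + (((m + j) C m) * ((j + α) C n))))) ℚ./ α !) {{α ℕₚ.!≢0}}
summand-as-fraction m n j {α} α≡ = begin
  (+ 1 ℚ./ suc (j + m)) ℚ.* (F⁻ ℚ./ j !) ℚ.* (F⁺ ℚ./ j !)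
    ≡⟨ cong (ℚ._* (F⁺ ℚ./ j !)) (/-*-/ (+ 1) F⁻ (suc (j + m)) (j !)) ⟩
  ((+ 1 ℤ.* F⁻) ℚ./ (suc (j + m) * j !)) ℚ.* (F⁺ ℚ./ j !)
    ≡⟨ /-*-/ (+ 1 ℤ.* F⁻) F⁺ (suc (j + m) * j !) (j !) ⟩
  (+ 1 ℤ.* F⁻ ℤ.* F⁺) ℚ./ (suc (j + m) * j ! * j !)
    ≡⟨ cong (λ x → (x ℤ.* F⁺) ℚ./ (suc (j + m) * j ! * j !)) (ℤₚ.*-identityˡ F⁻) ⟩
  (F⁻ ℤ.* F⁺) ℚ./ (suc (j + m) * j ! * j !)
    ≡⟨ /-cross (F⁻ ℤ.* F⁺) N (suc (j + m) * j ! * j !) (α !) (falling-*-falling m n j α≡) ⟩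
  N ℚ./ α ! ∎
  where
  open ≡-Reasoning
  N = + (m ! * n !) ℤ.* (sgn j ℤ.* (+ (n C j) ℤ.* + (((m + j) C m) * ((j + α) C n))))
  F⁻ = falling -[1+ α ] j
  F⁺ = falling (+ n) j
  instance
    j!≢0 : NonZero (j !)
    j!≢0 = j ℕₚ.!≢0
    α!≢0 : NonZero (α !)
    α!≢0 = α ℕₚ.!≢0
    [j+m+1]*j!≢0 : NonZero (suc (j + m) * j !)
    [j+m+1]*j!≢0 = ℕₚ.m*n≢0 (suc (j + m)) (j !)
    [j+m+1]*j!*j!≢0 : NonZero (suc (j + m) * j ! * j !)
    [j+m+1]*j!*j!≢0 = ℕₚ.m*n≢0 (suc (j + m) * j !) (j !)

alternating-sum-closed-form : ∀ m n {α} → α ≡ suc (m + n) →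
  sumTo n (λ j → (+ 1 ℚ./ suc (j + m)) ℚ.* binom -[1+ α ] j ℚ.* binom (+ n) j)
    ≡ ((+ (m ! * n !) ℤ.* (sgn n ℤ.* binomTripleSum m n α)) ℚ./ α !) {{α ℕₚ.!≢0}}
alternating-sum-closed-form m n {α} α≡ = begin
  sumTo n (λ j → (+ 1 ℚ./ suc (j + m)) ℚ.* binom -[1+ α ] j ℚ.* binom (+ n) j)
    ≡⟨ sumTo-cong n (λ j → summand-as-fraction m n j α≡) ⟩
  sumTo n (λ j → (P ℤ.* t j) ℚ./ α !)
    ≡⟨ sumTo-/ n (λ j → P ℤ.* t j) (α !) ⟩
  Σ≤ n (λ j → P ℤ.* t j) ℚ./ α !
    ≡⟨ cong (ℚ._/ α !) (trans (Σ≤-*ˡ n P t) (cong (P ℤ.*_) (Δ-binomial-binomial m n α))) ⟩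
  (P ℤ.* (sgn n ℤ.* binomTripleSum m n α)) ℚ./ α ! ∎
  where
  open ≡-Reasoning
  instance
    α!≢0 : NonZero (α !)
    α!≢0 = α ℕₚ.!≢0
  P = + (m ! * n !)
  t : ℕ → ℤ
  t j = sgn j ℤ.* (+ (n C j) ℤ.* + (((m + j) C m) * ((j + α) C n)))

closed-forms-agree : ∀ m n N →
  + (m ! * n !) ℤ.* (sgn n ℤ.* binomTripleSum m n N)
    ≡ sgn (suc (suc (m + n))) ℤ.* (+ (n ! * m !) ℤ.* (sgn m ℤ.* binomTripleSum n m N))
closed-forms-agree m n N = begin
  P ℤ.* (sgn n ℤ.* T)                              ≡⟨ ℤₚ.*-identityˡ (P ℤ.* (sgn n ℤ.* T)) ⟨
  1ℤ ℤ.* (P ℤ.* (sgn n ℤ.* T))                     ≡⟨ cong (ℤ._* (P ℤ.* (sgn n ℤ.* T))) (sgn-*-sgn m) ⟨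
  (sgn m ℤ.* sgn m) ℤ.* (P ℤ.* (sgn n ℤ.* T))      ≡⟨ regroup (sgn m) (sgn n) P T ⟩
  - - (sgn m ℤ.* sgn n) ℤ.* (P ℤ.* (sgn m ℤ.* T))  ≡⟨ cong (λ x → - - x ℤ.* (P ℤ.* (sgn m ℤ.* T))) (sgn-+ m n) ⟨
  - - sgn (m + n) ℤ.* (P ℤ.* (sgn m ℤ.* T))        ≡⟨ cong (λ x → - - sgn (m + n) ℤ.* (+ x ℤ.* (sgn m ℤ.* T))) (ℕₚ.*-comm (m !) (n !)) ⟩
  - - sgn (m + n) ℤ.* (P′ ℤ.* (sgn m ℤ.* T))       ≡⟨ cong (λ x → - - sgn (m + n) ℤ.* (P′ ℤ.* (sgn m ℤ.* x))) (binomTripleSum-comm m n N) ⟩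
  - - sgn (m + n) ℤ.* (P′ ℤ.* (sgn m ℤ.* T′))      ∎
  where
  open ≡-Reasoning
  P = + (m ! * n !)
  P′ = + (n ! * m !)
  T = binomTripleSum m n N
  T′ = binomTripleSum n m N
  regroup : ∀ x y p t → (x ℤ.* x) ℤ.* (p ℤ.* (y ℤ.* t)) ≡ - - (x ℤ.* y) ℤ.* (p ℤ.* (x ℤ.* t))
  regroup = ℤ-Solver.solve-∀

j+[m+1+n]∸[m+1]≡j+n : ∀ j m n → j + suc (m + n) ∸ suc m ≡ j + n
j+[m+1+n]∸[m+1]≡j+n j m n = trans (cong (_∸ suc m) (shuffle j m n)) (ℕₚ.m+n∸m≡n (suc m) (j + n))
  where
  shuffle : ∀ j m n → j + suc (m + n) ≡ suc m + (j + n)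
  shuffle = ℕ-Solver.solve-∀

lemma1 : (α β : ℕ) → 1 ≤ β → β ≤ α →
    sumTo (α ∸ β) (λ j → (+ 1 ℚ./ suc (j + β ∸ 1)) ℚ.* binom -[1+ α ] j ℚ.* binom (+ (α ∸ β)) j)
      ≡ sumTo (β ∸ 1) (λ j → (signPow (1 + α) ℚ.* (+ 1 ℚ./ suc (j + α ∸ β))) ℚ.* binom -[1+ α ] j ℚ.* binom (+ (β ∸ 1)) j)
lemma1 α (suc m) (s≤s z≤n) β≤α with ℕₚ.m≤n⇒∃[o]m+o≡n β≤α
... | n , refl rewrite ℕₚ.m+n∸m≡n m n = begin
  sumTo n (λ j → (+ 1 ℚ./ suc (j + suc m ∸ 1)) ℚ.* b j ℚ.* binom (+ n) j)
    ≡⟨ sumTo-cong n (λ j → cong (λ l → (+ 1 ℚ./ suc (l ∸ 1)) ℚ.* b j ℚ.* binom (+ n) j)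
                                (ℕₚ.+-suc j m)) ⟩
  sumTo n (λ j → (+ 1 ℚ./ suc (j + m)) ℚ.* b j ℚ.* binom (+ n) j)
    ≡⟨ alternating-sum-closed-form m n refl ⟩
  (+ (m ! * n !) ℤ.* (sgn n ℤ.* binomTripleSum m n α)) ℚ./ α !
    ≡⟨ cong (ℚ._/ α !) (closed-forms-agree m n α) ⟩
  (sgn (1 + α) ℤ.* (+ (n ! * m !) ℤ.* (sgn m ℤ.* binomTripleSum n m α))) ℚ./ α !
    ≡⟨ signPow-*-/ (1 + α) (+ (n ! * m !) ℤ.* (sgn m ℤ.* binomTripleSum n m α)) (α !) ⟨
  signPow (1 + α) ℚ.* ((+ (n ! * m !) ℤ.* (sgn m ℤ.* binomTripleSum n m α)) ℚ./ α !)
    ≡⟨ cong (signPow (1 + α) ℚ.*_) (alternating-sum-closed-form n m (cong suc (ℕₚ.+-comm m n))) ⟨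
  signPow (1 + α) ℚ.* sumTo m (λ j → (+ 1 ℚ./ suc (j + n)) ℚ.* b j ℚ.* binom (+ m) j)
    ≡⟨ sumTo-*ˡ m (signPow (1 + α)) (λ j → (+ 1 ℚ./ suc (j + n)) ℚ.* b j ℚ.* binom (+ m) j) ⟨
  sumTo m (λ j → signPow (1 + α) ℚ.* ((+ 1 ℚ./ suc (j + n)) ℚ.* b j ℚ.* binom (+ m) j))
    ≡⟨ sumTo-cong m rhs-summand ⟩
  sumTo m (λ j → (signPow (1 + α) ℚ.* (+ 1 ℚ./ suc (j + α ∸ suc m))) ℚ.* b j ℚ.* binom (+ m) j) ∎
  where
  open ≡-Reasoning
  instance
    α!≢0 : NonZero (α !)
    α!≢0 = α ℕₚ.!≢0
  b : ℕ → ℚ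
  b = binom -[1+ α ]
  rhs-summand : ∀ j → signPow (1 + α) ℚ.* ((+ 1 ℚ./ suc (j + n)) ℚ.* b j ℚ.* binom (+ m) j)
                    ≡ (signPow (1 + α) ℚ.* (+ 1 ℚ./ suc (j + α ∸ suc m))) ℚ.* b j ℚ.* binom (+ m) j
  rhs-summand j = begin
    s ℚ.* (a ℚ.* b j ℚ.* c)   ≡⟨ ℚₚ.*-assoc s (a ℚ.* b j) c ⟨
    s ℚ.* (a ℚ.* b j) ℚ.* c   ≡⟨ cong (ℚ._* c) (ℚₚ.*-assoc s a (b j)) ⟨
    s ℚ.* a ℚ.* b j ℚ.* c     ≡⟨ cong (λ l → s ℚ.* (+ 1 ℚ./ suc l) ℚ.* b j ℚ.* c) (j+[m+1+n]∸[m+1]≡j+n j m n) ⟨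
    s ℚ.* (+ 1 ℚ./ suc (j + α ∸ suc m)) ℚ.* b j ℚ.* c ∎
    where
    s = signPow (1 + α)
    a = + 1 ℚ./ suc (j + n)
    c = binom (+ m) j
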